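{- Let $G$ be a finite simple undirected graph. Then $G$ is P1-win if and only if there exist a connected component $H$ of $G$ and a trail $t = v_1 v_2 \ldots v_{m+1}$ in $H$ such that (a) Player 1 has a winning strategy for Trail Trap played on the graph $H$ alone in which Player 1's first move is $v_1 \to v_2$, and (b) every other connected component $H'$ of $G$ satisfies $\ell(H') < m$.
   Context: Trail Trap on a finite simple undirected graph $G$: Player 1 (P1) chooses a vertex, places a token on it and moves it along an incident edge $e$ to the other endpoint (a move $u\to v$ along edge $uv$). Player 2 (P2) then places their own token on any vertex and moves it along an incident edge $f \neq e$. Thereafter the players alternate, starting with P1, each moving their own token from its current vertex along an unused edge (an edge not previously traversed, in either direction, by either player) to the adjacent vertex; vertices may be revisited and the two tokens may share a vertex. The first player unable to move loses. $G$ is P1-win if P1 has a winning strategy, and P2-win otherwise. A trail is a walk with no repeated edge; its length is its number of edges. For a graph $H$, $\ell(H)$ denotes the maximum length of a trail in $H$. -}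

module Defs where

open import Data.Nat using (ℕ; _∸_; _<_)
open import Data.Fin using (Fin)
open import Data.List using (List; []; _∷_; length)
open import Data.List.Relation.Unary.Any using (Any)
open import Data.Product using (_×_; _,_; ∃; ∃-syntax)
open import Data.Sum using (_⊎_)
open import Relation.Nullary using (¬_; Dec)
open import Relation.Binary.PropositionalEquality using (_≡_)
open import Relation.Binary.Construct.Closure.ReflexiveTransitive using (Star)

record SimpleGraph (n : ℕ) : Set₁ where
  field
    Adj     : Fin n → Fin n → Set
    adj?    : (u v : Fin n) → Dec (Adj u v)
    sym     : ∀ {u v} → Adj u v → Adj v u
    irrefl  : ∀ {u} → ¬ Adj u u
open SimpleGraph public

module _ {n : ℕ} where
  V : Set
  V = Fin n

  -- edges as ordered pairs, compared as unordered pairs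
  Edge : Set
  Edge = V × V

  SameEdge : Edge → Edge → Set
  SameEdge (a , b) (c , d) = (a ≡ c × b ≡ d) ⊎ (a ≡ d × b ≡ c)

  Used : Edge → List Edge → Set
  Used e U = Any (SameEdge e) U

  edgesOf : List V → List Edge
  edgesOf (u ∷ v ∷ rest) = (u , v) ∷ edgesOf (v ∷ rest)
  edgesOf _ = []

  data Trail (E : V → V → Set) : List V → Set where
    single : ∀ v → Trail E (v ∷ [])
    step   : ∀ {u v rest} → E u v → ¬ Used (u , v) (edgesOf (v ∷ rest)) →
             Trail E (v ∷ rest) → Trail E (u ∷ v ∷ rest)

  trailLength : List V → ℕ
  trailLength t = length t ∸ 1

  -- Trail Trap played with edge relation E, after both tokens are placed.
  -- Win E a b U  : the player to move (token at a), opponent at b,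
  --                used edges U, has a winning strategy.
  -- Lose E a b U : the player to move (token at a) loses against
  --                every strategy... i.e. the opponent (at b) has a winning strategy.
  -- (The game is finite, so inductive definitions capture winning strategies.)
  data Win  (E : V → V → Set) : V → V → List Edge → Set
  data Lose (E : V → V → Set) : V → V → List Edge → Set

  data Win E where
    move : ∀ {a b U} (a' : V) → E a a' → ¬ Used (a , a') U →
           Lose E b a' ((a , a') ∷ U) → Win E a b U

  data Lose E where
    stuck-or-all : ∀ {a b U} →
           (∀ a' → E a a' → ¬ Used (a , a') U → Win E b a' ((a , a') ∷ U)) →
           Lose E a b U

  P1WinsWithFirst : (E : V → V → Set) → V → V → Set
  P1WinsWithFirst E v w =
    E v w × (∀ x y → E x y → ¬ SameEdge (x , y) (v , w) →
             Win E w y ((x , y) ∷ (v , w) ∷ []))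

  P1Win : (E : V → V → Set) → Set
  P1Win E = ∃[ v ] ∃[ w ] P1WinsWithFirst E v w

  InComp : SimpleGraph n → V → V → Set
  InComp G r u = Star (Adj G) r u

  -- Edge relation of the component H of r (the graph H; vertices outside H
  -- become isolated, which is irrelevant for the game and for trails).
  CompAdj : SimpleGraph n → V → V → V → Set
  CompAdj G r u v = Adj G u v × InComp G r u

  MaxTrailLt : SimpleGraph n → V → ℕ → Set
  MaxTrailLt G r m = ∀ (t : List V) → Trail (CompAdj G r) t → trailLength t < m

-- Suppose P1 wins by opening v₁ → v₂, and let t be a longest trail in the component H of v₁
-- beginning v₁ v₂.  If another component contained a trail of length ℓ ≥ |t|, P2 could open on
-- it and simply walk it; P1's winning strategy must answer every one of these ℓ moves, and its
-- answers stay inside H, so they extend v₁ v₂ to a trail of length ℓ + 1 > |t|.  Conversely,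
-- P1 opens along t.  If P2 answers inside H, play never leaves H and P1 uses the winning
-- strategy of (a); otherwise P1 just walks along t, while P2 is confined to a component
-- without trails of length m and so runs out of moves first.
module Submission where

open import Level using (0ℓ)
open import Data.Nat using (ℕ; zero; suc; _+_; _≤_; _<_; z≤n; s≤s; _≤?_)
open import Data.Nat.Properties using (≤-trans; +-suc; +-comm; ≤-reflexive; suc-injective; ≰⇒>; <⇒≤; ≤⇒≯; <-≤-trans)
open import Data.Fin using (Fin)
open import Data.Fin.Properties using (_≟_)
open import Data.List using (List; []; _∷_; _++_; length; allFin; cartesianProduct)
open import Data.List.Properties using (length-removeAt′)
open import Data.List.Relation.Unary.Any using (here; there; any?; _─_; index)
open import Data.List.Relation.Unary.Any.Properties using (¬Any[])
open import Data.List.Membership.Propositional using (_∈_; find; lose)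
open import Data.List.Membership.Propositional.Properties using (∈-allFin; ∈-cartesianProduct⁺)
open import Data.List.Membership.Setoid.Properties using (∈-resp-≈)
open import Data.Product using (_×_; _,_; proj₁; ∃-syntax)
open import Data.Sum using (_⊎_; inj₁; inj₂)
open import Data.Empty using (⊥-elim)
open import Function using (_∘_; _⇔_; mk⇔; Equivalence)
open import Relation.Nullary using (¬_; Dec; yes; no)
open import Relation.Nullary.Decidable using (map′; _×-dec_; _⊎-dec_)
open import Relation.Binary using (Rel; Setoid; Decidable)
open import Relation.Binary.PropositionalEquality using (_≡_; _≢_; refl; trans; subst) renaming (sym to ≡-sym)
open import Relation.Binary.Construct.Closure.ReflexiveTransitive using (Star; ε; _◅_; _◅◅_; reverse)
open import Defs

∈-─⁺ : ∀ {A : Set} {x y : A} {xs} (p : x ∈ xs) → y ∈ xs → y ≢ x → y ∈ (xs ─ p)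
∈-─⁺ (here refl) (here refl) y≢x = ⊥-elim (y≢x refl)
∈-─⁺ (here refl) (there q)   _   = q
∈-─⁺ (there p)   (here refl) _   = here refl
∈-─⁺ (there p)   (there q)   y≢x = there (∈-─⁺ p q y≢x)

length-─ : ∀ {A : Set} {x : A} {xs k} (p : x ∈ xs) → length xs ≡ suc k → length (xs ─ p) ≡ k
length-─ {xs = xs} p len = suc-injective (trans (≡-sym (length-removeAt′ xs (index p))) len)

module _ {n : ℕ} where

  SameEdge-refl : (e : Edge {n}) → SameEdge e e
  SameEdge-refl _ = inj₁ (refl , refl)

  SameEdge-swap : (a b : Fin n) → SameEdge (a , b) (b , a)
  SameEdge-swap _ _ = inj₂ (refl , refl)

  SameEdge-sym : {e f : Edge {n}} → SameEdge e f → SameEdge f e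
  SameEdge-sym {_ , _} {_ , _} (inj₁ (refl , refl)) = inj₁ (refl , refl)
  SameEdge-sym {_ , _} {_ , _} (inj₂ (refl , refl)) = inj₂ (refl , refl)

  SameEdge-trans : {e f g : Edge {n}} → SameEdge e f → SameEdge f g → SameEdge e g
  SameEdge-trans {_ , _} {_ , _} {_ , _} (inj₁ (refl , refl)) s                    = s
  SameEdge-trans {_ , _} {_ , _} {_ , _} (inj₂ (refl , refl)) (inj₁ (refl , refl)) = inj₂ (refl , refl)
  SameEdge-trans {_ , _} {_ , _} {_ , _} (inj₂ (refl , refl)) (inj₂ (refl , refl)) = inj₁ (refl , refl)

  SameEdge-setoid : Setoid 0ℓ 0ℓ
  SameEdge-setoid = record
    { Carrier       = Edge {n}
    ; _≈_           = SameEdge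
    ; isEquivalence = record { refl = SameEdge-refl _ ; sym = SameEdge-sym ; trans = SameEdge-trans }
    }

  Used-resp : {e f : Edge {n}} {U : List Edge} → SameEdge e f → Used e U → Used f U
  Used-resp = ∈-resp-≈ SameEdge-setoid

  SameEdge? : Decidable (SameEdge {n})
  SameEdge? (a , b) (c , d) = ((a ≟ c) ×-dec (b ≟ d)) ⊎-dec ((a ≟ d) ×-dec (b ≟ c))

  Used? : (e : Edge {n}) (U : List Edge) → Dec (Used e U)
  Used? e = any? (SameEdge? e)

  data FreshTrail (E : Fin n → Fin n → Set) : List (Edge {n}) → Fin n → List (Fin n) → Set where
    []   : ∀ {U u} → FreshTrail E U u []
    cons : ∀ {U u w l} → E u w → ¬ Used (u , w) U → FreshTrail E ((u , w) ∷ U) w l →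
           FreshTrail E U u (w ∷ l)

  module _ {E : Fin n → Fin n → Set} where

    FreshTrail-avoids : ∀ {U u l f} → FreshTrail E U u l → Used f (edgesOf (u ∷ l)) → ¬ Used f U
    FreshTrail-avoids (cons _ nu _) (here s)  fU = nu (Used-resp s fU)
    FreshTrail-avoids (cons _ _ t)  (there p) fU = FreshTrail-avoids t p (there fU)

    FreshTrail⇒Trail : ∀ {U u l} → FreshTrail E U u l → Trail E (u ∷ l)
    FreshTrail⇒Trail []             = single _
    FreshTrail⇒Trail (cons e _ t) =
      step e (λ p → FreshTrail-avoids t p (here (SameEdge-refl _))) (FreshTrail⇒Trail t)

    Trail⇒FreshTrail : ∀ {U u l} → Trail E (u ∷ l) →
                       (∀ {f} → Used f (edgesOf (u ∷ l)) → ¬ Used f U) → FreshTrail E U u l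
    Trail⇒FreshTrail (single _) _ = []
    Trail⇒FreshTrail {U} (step {u} {w} {rest} e nu t) disjoint =
      cons e (disjoint (here (SameEdge-refl _))) (Trail⇒FreshTrail t disjoint′)
      where
      disjoint′ : ∀ {f} → Used f (edgesOf (w ∷ rest)) → ¬ Used f ((u , w) ∷ U)
      disjoint′ p (here s)  = nu (Used-resp s p)
      disjoint′ p (there q) = disjoint (there p) q

    Trail-tail⇒FreshTrail : ∀ {u w l} → Trail E (u ∷ w ∷ l) → FreshTrail E ((u , w) ∷ []) w l
    Trail-tail⇒FreshTrail (step _ nu t) = Trail⇒FreshTrail t λ { p (here s) → nu (Used-resp s p) }

    FreshTrail-weaken : ∀ {U U′ u l} → (∀ {x y} → E x y → Used (x , y) U′ → Used (x , y) U) →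
                      FreshTrail E U u l → FreshTrail E U′ u l
    FreshTrail-weaken sub [] = []
    FreshTrail-weaken {U} {U′} sub (cons {u = u} {w} e nu t) = cons e (nu ∘ sub e) (FreshTrail-weaken sub′ t)
      where
      sub′ : ∀ {x y} → E x y → Used (x , y) ((u , w) ∷ U′) → Used (x , y) ((u , w) ∷ U)
      sub′ _ (here s)  = here s
      sub′ e (there p) = there (sub e p)

  module _ {E : Fin n → Fin n → Set} (E? : Decidable E) where

    LongestFreshTrail : List (Edge {n}) → Fin n → Set
    LongestFreshTrail U u =
      ∃[ l ] FreshTrail E U u l × (∀ {l′} → FreshTrail E U u l′ → length l′ ≤ length l)

    private
      LongestAmong : List (Edge {n}) → Fin n → List (Fin n) → Set
      LongestAmong U u ws = ∃[ l ] FreshTrail E U u l ×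
        (∀ {w l′} → w ∈ ws → FreshTrail E U u (w ∷ l′) → length (w ∷ l′) ≤ length l)

      longestAmong-∷ : ∀ {U u w ws} → LongestAmong U u (w ∷ []) → LongestAmong U u ws →
                       LongestAmong U u (w ∷ ws)
      longestAmong-∷ (l₁ , t₁ , max₁) (l₂ , t₂ , max₂) with length l₁ ≤? length l₂
      ... | yes l₁≤l₂ = l₂ , t₂ , λ { (here refl) t → ≤-trans (max₁ (here refl) t) l₁≤l₂
                                    ; (there w∈) t → max₂ w∈ t }
      ... | no  l₁≰l₂ = l₁ , t₁ , λ { (here refl) t → max₁ (here refl) t
                                    ; (there w∈) t → ≤-trans (max₂ w∈ t) (<⇒≤ (≰⇒> l₁≰l₂)) }

      -- The search terminates because every step uses up one of the finitely many edges in Av.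
      longestThrough : ∀ k {U u Av} → length Av ≡ k → (∀ {e} → ¬ Used e U → e ∈ Av) →
                       ∀ w → LongestAmong U u (w ∷ [])
      longest : ∀ k {U u Av} → length Av ≡ k → (∀ {e} → ¬ Used e U → e ∈ Av) →
                LongestFreshTrail U u

      longestThrough zero {Av = []} _ covers w =
        [] , [] , λ { (here refl) (cons _ nu _) → ⊥-elim (¬Any[] (covers nu)) }
      longestThrough (suc k) {U} {u} {Av} len covers w with E? u w | Used? (u , w) U
      ... | no ¬e | _       = [] , [] , λ { (here refl) (cons e _ _) → ⊥-elim (¬e e) }
      ... | yes _ | yes used = [] , [] , λ { (here refl) (cons _ nu _) → ⊥-elim (nu used) }
      ... | yes e | no nu with longest k (length-─ uw∈Av len) covers′
        where
        uw∈Av : (u , w) ∈ Av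
        uw∈Av = covers nu
        covers′ : ∀ {f} → ¬ Used f ((u , w) ∷ U) → f ∈ (Av ─ uw∈Av)
        covers′ nu′ = ∈-─⁺ uw∈Av (covers (nu′ ∘ there)) (λ { refl → nu′ (here (SameEdge-refl _)) })
      ...   | l , t , max = (w ∷ l) , cons e nu t , λ { (here refl) (cons _ _ t′) → s≤s (max t′) }

      longest k {U} {u} len covers with among (allFin n)
        where
        among : ∀ ws → LongestAmong U u ws
        among []       = [] , [] , λ ()
        among (w ∷ ws) = longestAmong-∷ (longestThrough k len covers w) (among ws)
      ... | l , t , max = l , t , λ { [] → z≤n ; t′@(cons _ _ _) → max (∈-allFin _) t′ }

    longestFreshTrail : ∀ U u → LongestFreshTrail U u
    longestFreshTrail U u = longest _ {Av = cartesianProduct (allFin n) (allFin n)} refl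
      λ { {a , b} _ → ∈-cartesianProduct⁺ (∈-allFin a) (∈-allFin b) }

  module _ {R : Rel (Fin n) 0ℓ} (R? : Decidable R) (r : Fin n) where

    private
      Closed : List (Fin n) → Set
      Closed S = ∀ {y z} → y ∈ S → R y z → z ∈ S

      Closed-Star : ∀ {S y x} → Closed S → y ∈ S → Star R y x → x ∈ S
      Closed-Star closed y∈S ε           = y∈S
      Closed-Star closed y∈S (yRz ◅ zRx) = Closed-Star closed (closed y∈S yRz) zRx

      -- S holds vertices known to be reachable from r, C every other vertex (and possibly more).
      saturate : ∀ k S C → length C ≡ k → (∀ v → v ∈ S ⊎ v ∈ C) →
                 (∀ {v} → v ∈ S → Star R r v) → r ∈ S → ∃[ S′ ] (∀ {v} → v ∈ S′ ⇔ Star R r v)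
      saturate k S C len partition reach r∈S with any? (λ z → any? (λ y → R? y z) S) C
      ... | no noEdge = S , mk⇔ reach (Closed-Star closed r∈S)
        where
        closed : Closed S
        closed {z = z} y∈S yRz with partition z
        ... | inj₁ z∈S = z∈S
        ... | inj₂ z∈C = ⊥-elim (noEdge (lose z∈C (lose y∈S yRz)))
      saturate zero S [] _ _ _ _ | yes ()
      saturate (suc k) S C len partition reach r∈S | yes edge with find edge
      ... | z , z∈C , toZ with find toZ
      ... | y , y∈S , yRz =
        saturate k (z ∷ S) (C ─ z∈C) (length-─ z∈C len) partition′ reach′ (there r∈S)
        where
        partition′ : ∀ v → v ∈ z ∷ S ⊎ v ∈ (C ─ z∈C)
        partition′ v with partition v | v ≟ z
        ... | inj₁ v∈S | _        = inj₁ (there v∈S)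
        ... | inj₂ _   | yes refl = inj₁ (here refl)
        ... | inj₂ v∈C | no v≢z   = inj₂ (∈-─⁺ z∈C v∈C v≢z)
        reach′ : ∀ {v} → v ∈ z ∷ S → Star R r v
        reach′ (here refl) = reach y∈S ◅◅ yRz ◅ ε
        reach′ (there v∈S) = reach v∈S

    Star? : ∀ x → Dec (Star R r x)
    Star? x with saturate _ (r ∷ []) (allFin n) refl (inj₂ ∘ ∈-allFin) (λ { (here refl) → ε }) (here refl)
    ... | S , S≐Star = map′ (Equivalence.to S≐Star) (Equivalence.from S≐Star) (x ∈? S)
      where open import Data.List.Membership.DecPropositional (_≟_ {n}) using (_∈?_)

  module _ {E E′ : Fin n → Fin n → Set} (P : Fin n → Set)
           (closed : ∀ {x y} → P x → E x y → P y)
           (E⇒E′ : ∀ {x y} → P x → E x y → E′ x y)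
           (E′⇒E : ∀ {x y} → P x → E′ x y → E x y) where

    Win-local  : ∀ {a b U} → P a → P b → Win E a b U → Win E′ a b U
    Lose-local : ∀ {a b U} → P a → P b → Lose E a b U → Lose E′ a b U
    Win-local pa pb (move a′ e nu l) = move a′ (E⇒E′ pa e) nu (Lose-local pb (closed pa e) l)
    Lose-local pa pb (stuck-or-all f) = stuck-or-all λ a′ e′ nu →
      Win-local pb (closed pa (E′⇒E pa e′)) (f a′ (E′⇒E pa e′) nu)

module _ {n : ℕ} (G : SimpleGraph n) where

  InComp-step : ∀ {r x y} → InComp G r x → Adj G x y → InComp G r y
  InComp-step r↝x xy = r↝x ◅◅ xy ◅ ε

  InComp-sym : ∀ {r x} → InComp G r x → InComp G x r
  InComp-sym = reverse (sym G)

  InComp-join : ∀ {r r′ x} → InComp G r x → InComp G r′ x → InComp G r r′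
  InComp-join r↝x r′↝x = r↝x ◅◅ InComp-sym r′↝x

  InComp? : ∀ r x → Dec (InComp G r x)
  InComp? = Star? (adj? G)

  CompAdj? : ∀ r → Decidable (CompAdj G r)
  CompAdj? r u v = adj? G u v ×-dec InComp? r u

  SameEdge-separated : ∀ {r r′ x y a b} → ¬ InComp G r r′ → InComp G r′ x → CompAdj G r a b →
                       ¬ SameEdge (x , y) (a , b)
  SameEdge-separated nr r′↝x (_  , r↝a) (inj₁ (refl , refl)) = nr (InComp-join r↝a r′↝x)
  SameEdge-separated nr r′↝x (ab , r↝a) (inj₂ (refl , refl)) = nr (InComp-join (InComp-step r↝a ab) r′↝x)

  FreshTrail-insertForeign : ∀ {r r′ a b U u l} → ¬ InComp G r r′ → CompAdj G r a b → ∀ X →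
    FreshTrail (CompAdj G r′) (X ++ U) u l → FreshTrail (CompAdj G r′) (X ++ (a , b) ∷ U) u l
  FreshTrail-insertForeign {r} {r′} {a} {b} {U} nr ab X = FreshTrail-weaken (λ xy → skip X xy)
    where
    skip : ∀ {x y} X → CompAdj G r′ x y → Used (x , y) (X ++ (a , b) ∷ U) → Used (x , y) (X ++ U)
    skip []      (_ , r′↝x) (here s)  = ⊥-elim (SameEdge-separated nr r′↝x ab s)
    skip []      _          (there p) = p
    skip (_ ∷ X) _          (here s)  = here s
    skip (_ ∷ X) xy         (there p) = there (skip X xy p)

  Win-restrict : ∀ {r a b U} → InComp G r a → InComp G r b → Win (Adj G) a b U → Win (CompAdj G r) a b U
  Win-restrict {r} = Win-local (InComp G r) InComp-step (λ r↝x xy → xy , r↝x) (λ _ → proj₁)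

  Win-extend : ∀ {r a b U} → InComp G r a → InComp G r b → Win (CompAdj G r) a b U → Win (Adj G) a b U
  Win-extend {r} =
    Win-local (InComp G r) (λ r↝x xy → InComp-step r↝x (proj₁ xy)) (λ _ → proj₁) (λ r↝x xy → xy , r↝x)

  -- A winner must answer every move, so an opponent walking a fresh trail elsewhere forces
  -- at least as many moves, all inside the winner's component.
  Win⇒longerFreshTrail : ∀ {r r′ a b U q} → ¬ InComp G r r′ → InComp G r a →
    FreshTrail (CompAdj G r′) U b q → Win (Adj G) a b U →
    ∃[ l ] FreshTrail (CompAdj G r) U a l × length q < length l
  Win⇒longerFreshTrail nr r↝a [] (move a′ aa′ nu _) = (a′ ∷ []) , cons (aa′ , r↝a) nu [] , s≤s z≤n
  Win⇒longerFreshTrail {a = a} {b} {U} nr r↝a (cons {w = b′} (bb′ , r′↝b) nu-bb′ rest)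
                       (move a′ aa′ nu (stuck-or-all answer))
    with Win⇒longerFreshTrail nr (InComp-step r↝a aa′)
           (FreshTrail-insertForeign nr (aa′ , r↝a) ((b , b′) ∷ []) rest) (answer b′ bb′ bb′-fresh)
    where
    bb′-fresh : ¬ Used (b , b′) ((a , a′) ∷ U)
    bb′-fresh (here s)  = SameEdge-separated nr r′↝b (aa′ , r↝a) s
    bb′-fresh (there p) = nu-bb′ p
  ... | l , t , q<l = (a′ ∷ l) , cons (aa′ , r↝a) nu (FreshTrail-weaken (λ _ → there) t) , s≤s q<l

  -- The opponent's moves so far form the trail b ∷ hist (in reverse), which can only grow.
  longerFreshTrail⇒Win : ∀ {r r′ m a b U p hist} → ¬ InComp G r r′ → MaxTrailLt G r′ m →
    FreshTrail (CompAdj G r) U a p → InComp G r′ b → Trail (CompAdj G r′) (b ∷ hist) →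
    (∀ {e} → Used e (edgesOf (b ∷ hist)) → Used e U) → m ≤ length p + length hist →
    Win (Adj G) a b U
  longerFreshTrail⇒Win {b = b} {hist = hist} _ short [] _ th _ m≤ = ⊥-elim (≤⇒≯ m≤ (short (b ∷ hist) th))
  longerFreshTrail⇒Win {m = m} {b = b} {p = a₁ ∷ p} {hist} nr short (cons aa₁ nu rest) r′↝b th hist⊆U m≤ =
    move a₁ (proj₁ aa₁) nu (stuck-or-all λ b′ bb′ nu-bb′ →
      longerFreshTrail⇒Win nr short
        (FreshTrail-insertForeign (nr ∘ InComp-sym) (bb′ , r′↝b) [] rest)
        (InComp-step r′↝b bb′)
        (step (sym G bb′ , InComp-step r′↝b bb′)
              (λ used → nu-bb′ (there (Used-resp (SameEdge-swap b′ b) (hist⊆U used)))) th)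
        (λ { (here s) → here (SameEdge-trans s (SameEdge-swap b′ b))
           ; (there e∈) → there (there (hist⊆U e∈)) })
        (subst (m ≤_) (≡-sym (+-suc (length p) (length hist))) m≤))

  Criterion : Set
  Criterion = ∃[ r ] ∃[ v₁ ] ∃[ v₂ ] ∃[ rest ]
    ( Trail (CompAdj G r) (v₁ ∷ v₂ ∷ rest)
    × P1WinsWithFirst (CompAdj G r) v₁ v₂
    × (∀ r′ → ¬ InComp G r r′ → MaxTrailLt G r′ (trailLength (v₁ ∷ v₂ ∷ rest))))

  P1Win⇒Criterion : P1Win (Adj G) → Criterion
  P1Win⇒Criterion (v , w , vw , wins) with longestFreshTrail (CompAdj? v) ((v , w) ∷ []) w
  ... | l , t , max =
    v , v , w , l , FreshTrail⇒Trail (cons (vw , ε) (λ ()) t) , ((vw , ε) , winsInH) , othersShort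
    where
    winsInH : ∀ x y → CompAdj G v x y → ¬ SameEdge (x , y) (v , w) →
              Win (CompAdj G v) w y ((x , y) ∷ (v , w) ∷ [])
    winsInH x y (xy , v↝x) ns = Win-restrict (InComp-step ε vw) (InComp-step v↝x xy) (wins x y xy ns)

    othersShort : ∀ r′ → ¬ InComp G v r′ → MaxTrailLt G r′ (suc (length l))
    othersShort r′ nr (_ ∷ []) _ = s≤s z≤n
    othersShort r′ nr (x ∷ y ∷ q) tr@(step (xy , r′↝x) _ _)
      with Win⇒longerFreshTrail nr (InComp-step ε vw)
             (FreshTrail-insertForeign nr (vw , ε) ((x , y) ∷ []) (Trail-tail⇒FreshTrail tr))
             (wins x y xy (SameEdge-separated nr r′↝x (vw , ε)))
    ... | l′ , t′ , q<l′ = s≤s (<-≤-trans q<l′ (max (FreshTrail-weaken (λ _ → there) t′)))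

  Criterion⇒P1Win : Criterion → P1Win (Adj G)
  Criterion⇒P1Win (r , v₁ , v₂ , rest , tr@(step (v₁v₂ , r↝v₁) _ _) , (_ , winsInH) , othersShort) =
    v₁ , v₂ , v₁v₂ , answer
    where
    answer : ∀ x y → Adj G x y → ¬ SameEdge (x , y) (v₁ , v₂) →
             Win (Adj G) v₂ y ((x , y) ∷ (v₁ , v₂) ∷ [])
    answer x y xy ns with InComp? r x
    ... | yes r↝x = Win-extend (InComp-step r↝v₁ v₁v₂) (InComp-step r↝x xy) (winsInH x y (xy , r↝x) ns)
    ... | no nx = longerFreshTrail⇒Win nx (othersShort x nx)
      (FreshTrail-insertForeign (nx ∘ InComp-sym) (xy , ε) [] (Trail-tail⇒FreshTrail tr))
      (InComp-step ε xy) (step (sym G xy , InComp-step ε xy) (λ ()) (single x))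
      (λ { (here s) → here (SameEdge-trans s (SameEdge-swap y x)) ; (there ()) })
      (≤-reflexive (+-comm 1 (length rest)))

proposition2p1 : ∀ {n : ℕ} (G : SimpleGraph n) →
    P1Win (Adj G) ⇔
    (∃[ r ] ∃[ v₁ ] ∃[ v₂ ] ∃[ rest ]
       ( Trail (CompAdj G r) (v₁ ∷ v₂ ∷ rest)
       × P1WinsWithFirst (CompAdj G r) v₁ v₂
       × (∀ r′ → ¬ InComp G r r′ →
            MaxTrailLt G r′ (trailLength (v₁ ∷ v₂ ∷ rest)))))
proposition2p1 G = mk⇔ (P1Win⇒Criterion G) (Criterion⇒P1Win G)
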